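{- Let $n, m \in \mathbb{N}$ with $m > 0$, and let $s = (s_0, \dotsc, s_{n-1})$ and $t = (t_0, \dotsc, t_{m-1})$ be Boolean input variables. Let $k$ be an integer with $0 \leq k < \frac{m-1}{2}$. Let $t' = (t_0, t_1, \dotsc, t_{2k})$, $t'' = (t_{2k+1}, \dotsc, t_{m-1})$, and $\widehat{t'} := (t_1, t_3, t_5, \dotsc, t_{2k-1})$ (every second entry of $t'$; empty if $k=0$). Then, as Boolean functions, \[ f^*(s, t) = f^*(s, t') \lor f(\widehat{t'}, t''). \]
   Context: For Boolean variables $t = (t_0, \dotsc, t_{m-1})$ with $m \geq 1$, the \textsc{And}-\textsc{Or} paths $g$ and $g^*$ are defined recursively by $g(t) = t_0$ and $g^*(t) = t_0$ if $m = 1$, and for $m > 1$ by $g(t) = t_0 \land g^*((t_1, \dotsc, t_{m-1}))$ and $g^*(t) = t_0 \lor g((t_1, \dotsc, t_{m-1}))$. For $s = (s_0, \dotsc, s_{n-1})$ (possibly empty, $n \ge 0$) and $t$ with $m\ge 1$, the extended \textsc{And}-\textsc{Or} paths are $f(s,t) = s_0 \land \dotsb \land s_{n-1} \land g(t)$ and $f^*(s,t) = s_0 \lor \dotsb \lor s_{n-1} \lor g^*(t)$ (so $f((),t) = g(t)$, $f^*((),t)=g^*(t)$). -}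

module Defs where

open import Data.Bool using (Bool; true; false; _∧_; _∨_)
open import Data.Nat using (ℕ; zero; suc; _+_; _*_; _∸_; _<_; _≤_; s≤s; z≤n)
open import Data.Nat.Properties using (≤-trans; <⇒≤; ≤-reflexive; n≤1+n; +-monoʳ-<; *-monoʳ-≤; +-suc; +-monoʳ-≤; m+[n∸m]≡n)
open import Data.Fin using (Fin; fromℕ<; toℕ)
open import Data.Fin.Properties using (toℕ<n)
open import Data.Vec using (Vec; []; _∷_; foldr; lookup; tabulate)
open import Relation.Binary.PropositionalEquality using (_≡_; refl; sym; trans; cong)

mutual
  g : ∀ {m} → Vec Bool (suc m) → Bool
  g (t₀ ∷ [])      = t₀
  g (t₀ ∷ t₁ ∷ ts) = t₀ ∧ g* (t₁ ∷ ts)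

  g* : ∀ {m} → Vec Bool (suc m) → Bool
  g* (t₀ ∷ [])      = t₀
  g* (t₀ ∷ t₁ ∷ ts) = t₀ ∨ g (t₁ ∷ ts)

f : ∀ {n m} → Vec Bool n → Vec Bool (suc m) → Bool
f s t = foldr _ _∧_ (g t) s

f* : ∀ {n m} → Vec Bool n → Vec Bool (suc m) → Bool
f* s t = foldr _ _∨_ (g* t) s

t′ : ∀ {m} (k : ℕ) → suc (2 * k) < m → Vec Bool m → Vec Bool (suc (2 * k))
t′ k lt t = tabulate λ i → lookup t (fromℕ< (≤-trans (toℕ<n i) (<⇒≤ lt)))

-- t'' = (t_{2k+1}, ..., t_{m-1}), of length m - (2k+1) ≥ 1 (requires 2k+1 < m).
-- Its length is written suc (m ∸ (2k+2)); entry j of t'' is t_{2k+1+j}.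
t″ : ∀ {m} (k : ℕ) → suc (2 * k) < m → Vec Bool m → Vec Bool (suc (m ∸ suc (suc (2 * k))))
t″ {m} k lt t = tabulate λ j → lookup t (fromℕ< (bound j))
  where
  bound : (j : Fin (suc (m ∸ suc (suc (2 * k))))) → suc (2 * k) + toℕ j < m
  bound j = ≤-trans (≤-reflexive (sym (+-suc (suc (2 * k)) (toℕ j))))
              (≤-trans (+-monoʳ-≤ (suc (2 * k)) (toℕ<n j))
                       (≤-reflexive (trans (+-suc (suc (2 * k)) _) (m+[n∸m]≡n lt))))

t̂′ : ∀ {m} (k : ℕ) → suc (2 * k) < m → Vec Bool m → Vec Bool k
t̂′ {m} k lt t = tabulate λ j → lookup t (fromℕ< (bound j))
  where
  bound : (j : Fin k) → suc (2 * toℕ j) < m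
  bound j = ≤-trans (≤-trans (≤-reflexive (sym (2*suc (toℕ j))))
                       (*-monoʳ-≤ 2 (toℕ<n j))) (≤-trans (n≤1+n _) (<⇒≤ lt))
    where
    2*suc : ∀ x → 2 * suc x ≡ suc (suc (2 * x))
    2*suc x = trans (cong suc (+-suc x (x + 0))) refl

module Submission where

open import Defs
open import Data.Bool using (Bool; true; false; _∨_; _∧_)
open import Data.Bool.Properties using (∨-assoc)
open import Data.Nat using (ℕ; zero; suc; _*_; _<_; _+_; _∸_; s≤s)
open import Data.Nat.Properties
  using (*-suc; *-monoʳ-≤; +-monoʳ-≤; m+[n∸m]≡n; ≤-pred; ≤-trans; <-trans; ≤-<-trans; <⇒≤; ≤-reflexive)
open import Data.Fin using (Fin; toℕ; fromℕ<)
open import Data.Fin.Properties using (toℕ<n)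
open import Data.Vec using (Vec; []; _∷_; foldr; lookup; tabulate)
open import Data.Vec.Properties using (tabulate-cong; foldr-fusion)
open import Function using (_∘_)
open import Relation.Binary.PropositionalEquality
  using (_≡_; refl; sym; trans; cong; cong₂; module ≡-Reasoning)

-- Unfolding two steps, g*(a, b, r) = a ∨ (b ∧ g*(r)).  By induction on k, g*(r) splits as
-- g*(r′) ∨ f(r̂′, r″); distributing b, the part a ∨ (b ∧ g*(r′)) is g*(t′), while b joins the
-- conjunction f(r̂′, r″) as the next odd entry of t̂′.

tabulateℕ : ∀ {a} {A : Set a} n → (ℕ → A) → Vec A n
tabulateℕ n h = tabulate (h ∘ toℕ)

lookupℕ : ∀ {a} {A : Set a} {n} → A → Vec A n → ℕ → A
lookupℕ d []       _       = d
lookupℕ d (x ∷ xs) zero    = x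
lookupℕ d (x ∷ xs) (suc i) = lookupℕ d xs i

lookup-fromℕ< : ∀ {a} {A : Set a} {n} (d : A) (xs : Vec A n) {i} (i<n : i < n) →
                lookup xs (fromℕ< i<n) ≡ lookupℕ d xs i
lookup-fromℕ< d (x ∷ xs) {zero}  _         = refl
lookup-fromℕ< d (x ∷ xs) {suc i} (s≤s i<n) = lookup-fromℕ< d xs i<n

tabulate-lookupℕ : ∀ {a} {A : Set a} {n} (d : A) (xs : Vec A n) →
                   tabulateℕ n (lookupℕ d xs) ≡ xs
tabulate-lookupℕ d []       = refl
tabulate-lookupℕ d (x ∷ xs) = cong (x ∷_) (tabulate-lookupℕ d xs)

tabulate-lookup-fromℕ< : ∀ {a} {A : Set a} {k n} (d : A) (xs : Vec A n) (σ : ℕ → ℕ)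
                         (σ<n : (i : Fin k) → σ (toℕ i) < n) →
                         tabulate (λ i → lookup xs (fromℕ< (σ<n i))) ≡ tabulateℕ k (lookupℕ d xs ∘ σ)
tabulate-lookup-fromℕ< d xs σ σ<n = tabulate-cong (λ i → lookup-fromℕ< d xs (σ<n i))

-- fromℕ< takes its bound irrelevantly, so the bounds below need not be the ones in Defs.

t′-tabulateℕ : ∀ {m} k (lt : suc (2 * k) < suc m) (t : Vec Bool (suc m)) →
               t′ k lt t ≡ tabulateℕ (suc (2 * k)) (lookupℕ false t)
t′-tabulateℕ k lt t = tabulate-lookup-fromℕ< false t (λ i → i) (λ i → <-trans (toℕ<n i) lt)

t̂′-tabulateℕ : ∀ {m} k (lt : suc (2 * k) < suc m) (t : Vec Bool (suc m)) →
               t̂′ k lt t ≡ tabulateℕ k (λ j → lookupℕ false t (suc (2 * j)))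
t̂′-tabulateℕ k lt t = tabulate-lookup-fromℕ< false t (λ j → suc (2 * j))
  (λ j → s≤s (≤-<-trans (*-monoʳ-≤ 2 (<⇒≤ (toℕ<n j))) (≤-pred lt)))

t″-tabulateℕ : ∀ {m} k (lt : suc (2 * k) < suc m) (t : Vec Bool (suc m)) →
               t″ k lt t ≡ tabulateℕ (suc (m ∸ suc (2 * k))) (λ j → lookupℕ false t (suc (2 * k) + j))
t″-tabulateℕ k lt t = tabulate-lookup-fromℕ< false t (suc (2 * k) +_)
  (λ j → s≤s (≤-trans (+-monoʳ-≤ (suc (2 * k)) (≤-pred (toℕ<n j)))
                      (≤-reflexive (m+[n∸m]≡n (≤-pred lt)))))

foldr-∨-∨ : ∀ {n} (s : Vec Bool n) x y → foldr _ _∨_ (x ∨ y) s ≡ foldr _ _∨_ x s ∨ y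
foldr-∨-∨ s x y = sym (foldr-fusion x (_∨ y) (λ b z → ∨-assoc b z y) s)

∨-∧-∨-distrib : ∀ a b x y → a ∨ (b ∧ (x ∨ y)) ≡ (a ∨ (b ∧ x)) ∨ (b ∧ y)
∨-∧-∨-distrib true  b     x y = refl
∨-∧-∨-distrib false true  x y = refl
∨-∧-∨-distrib false false x y = refl

-- The prefix length 2k is abstracted as l: for k + 1 it must be matched as
-- suc (suc (2 * k)), a form that 2 * suc k does not reduce to.
g*-tabulateℕ-split : ∀ k {l} m (h : ℕ → Bool) → 2 * k ≡ l → l < m →
  g* (tabulateℕ (suc m) h) ≡
    g* (tabulateℕ (suc l) h) ∨
    f (tabulateℕ k (λ j → h (suc (2 * j))))
      (tabulateℕ (suc (m ∸ suc l)) (λ j → h (suc l + j)))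
g*-tabulateℕ-split zero    (suc m) h refl _ = refl
g*-tabulateℕ-split (suc k) m h 2k+2≡l lt with trans (sym (*-suc 2 k)) 2k+2≡l
g*-tabulateℕ-split (suc k) (suc (suc m)) h _ (s≤s (s≤s lt)) | refl = begin
  h 0 ∨ (h 1 ∧ g* (tabulateℕ (suc m) h₂))
    ≡⟨ cong (λ z → h 0 ∨ (h 1 ∧ z)) (g*-tabulateℕ-split k m h₂ refl lt) ⟩
  h 0 ∨ (h 1 ∧ (prefix ∨ f (tabulateℕ k odd₂) rest))
    ≡⟨ ∨-∧-∨-distrib (h 0) (h 1) prefix _ ⟩
  (h 0 ∨ (h 1 ∧ prefix)) ∨ (h 1 ∧ f (tabulateℕ k odd₂) rest)
    ≡⟨ cong (λ o → (h 0 ∨ (h 1 ∧ prefix)) ∨ (h 1 ∧ f o rest)) odd₂≡odd∘suc ⟩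
  (h 0 ∨ (h 1 ∧ prefix)) ∨ (h 1 ∧ f (tabulateℕ k (λ j → h (suc (2 * suc j)))) rest) ∎
  where
  open ≡-Reasoning
  h₂ odd₂ : ℕ → Bool
  h₂ = h ∘ suc ∘ suc
  odd₂ j = h₂ (suc (2 * j))
  prefix : Bool
  prefix = g* (tabulateℕ (suc (2 * k)) h₂)
  rest : Vec Bool (suc (m ∸ suc (2 * k)))
  rest = tabulateℕ (suc (m ∸ suc (2 * k))) (λ j → h₂ (suc (2 * k) + j))
  odd₂≡odd∘suc : tabulateℕ k odd₂ ≡ tabulateℕ k (λ j → h (suc (2 * suc j)))
  odd₂≡odd∘suc = tabulate-cong (cong (h ∘ suc) ∘ sym ∘ *-suc 2 ∘ toℕ)

g*-split : ∀ {m} k (lt : suc (2 * k) < suc m) (t : Vec Bool (suc m)) →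
           g* t ≡ g* (t′ k lt t) ∨ f (t̂′ k lt t) (t″ k lt t)
g*-split {m} k lt t = begin
  g* t
    ≡⟨ cong g* (sym (tabulate-lookupℕ false t)) ⟩
  g* (tabulateℕ (suc m) (lookupℕ false t))
    ≡⟨ g*-tabulateℕ-split k m (lookupℕ false t) refl (≤-pred lt) ⟩
  _ ≡⟨ sym (cong₂ _∨_ (cong g* (t′-tabulateℕ k lt t))
                      (cong₂ f (t̂′-tabulateℕ k lt t) (t″-tabulateℕ k lt t))) ⟩
  g* (t′ k lt t) ∨ f (t̂′ k lt t) (t″ k lt t) ∎
  where open ≡-Reasoning

lemma2p5 : (n m k : ℕ) (lt : suc (2 * k) < suc m) (s : Vec Bool n) (t : Vec Bool (suc m)) →
    f* s t ≡ (f* s (t′ k lt t) ∨ f (t̂′ k lt t) (t″ k lt t))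
lemma2p5 n m k lt s t = begin
  foldr _ _∨_ (g* t) s
    ≡⟨ cong (λ b → foldr _ _∨_ b s) (g*-split k lt t) ⟩
  foldr _ _∨_ (g* (t′ k lt t) ∨ f (t̂′ k lt t) (t″ k lt t)) s
    ≡⟨ foldr-∨-∨ s _ _ ⟩
  f* s (t′ k lt t) ∨ f (t̂′ k lt t) (t″ k lt t) ∎
  where open ≡-Reasoning
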